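{- Let $G$ be a graph, $H$ a non-null subgraph of $G$, and let $n_0$ be the maximum number of vertices in a connected component of $H$. For every independent set $I\subseteq V(G)\setminus V(H)$ of $G$ and every nonnegative integer $k$ with $k\leq \alpha(H)-i(H-N(I))$, there exists an independent set $I_1\subseteq I$ with $|I_1|\leq kn_0$ such that $k\leq \alpha(H)-i(H-N(I_1))$.
   Context: All graphs are finite and simple; the null graph is allowed, with $\alpha=i=0$. For a graph $G$, $\alpha(G)$ is the maximum size of an independent set and $i(G)$ is the minimum size of an inclusion-maximal independent set. $N(I)=\bigcup_{v\in I}N_G(v)$ is the open neighborhood in $G$, and $H-N(I)$ is obtained from $H$ by deleting the vertices of $N(I)\cap V(H)$. -}

module Defs where

open import Data.Nat using (ℕ; zero; suc; _≤_; _⊔_; _⊓_)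
open import Data.Bool using (Bool; true; false; _∧_; _∨_; not; if_then_else_)
open import Data.Fin using (Fin)
open import Data.Vec using (Vec; []; _∷_; lookup; tabulate)
open import Data.List using (List; []; _∷_; map; foldr; _++_; allFin; filterᵇ)
open import Data.Bool.ListAction using (all; any)
open import Data.Fin.Subset using (Subset; _∈_; _∉_; _⊆_; ∣_∣; ⊤)
open import Data.Product using (Σ; _×_; ∃; ∃-syntax)
open import Function.Bundles using (_⇔_)
open import Relation.Binary.PropositionalEquality using (_≡_)

record Graph (n : ℕ) : Set where
  field
    adj    : Fin n → Fin n → Bool
    sym    : ∀ u v → adj u v ≡ adj v u
    irrefl : ∀ v → adj v v ≡ false
open Graph public

record VGraph (n : ℕ) : Set where
  field
    V : Subset n
    E : Fin n → Fin n → Bool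
open VGraph public

asV : ∀ {n} → Graph n → VGraph n
asV G = record { V = ⊤ ; E = adj G }

record IsSubgraph {n : ℕ} (G : Graph n) (H : VGraph n) : Set where
  field
    E-sym   : ∀ u v → E H u v ≡ E H v u
    E-sub   : ∀ u v → E H u v ≡ true → adj G u v ≡ true
    E-verts : ∀ u v → E H u v ≡ true → u ∈ V H

NonNull : ∀ {n} → VGraph n → Set
NonNull {n} H = ∃[ v ] v ∈ V H

allSubsets : ∀ n → List (Subset n)
allSubsets zero = [] ∷ []
allSubsets (suc n) = map (true ∷_) xs ++ map (false ∷_) xs
  where xs = allSubsets n

subsetᵇ : ∀ {n} → Subset n → Subset n → Bool
subsetᵇ {n} S T = all (λ v → not (lookup S v) ∨ lookup T v) (allFin n)

indepᵇ : ∀ {n} → VGraph n → Subset n → Bool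
indepᵇ {n} H S =
  subsetᵇ S (V H) ∧
  all (λ u → all (λ v → not (lookup S u ∧ lookup S v ∧ E H u v)) (allFin n)) (allFin n)

maximalIndepᵇ : ∀ {n} → VGraph n → Subset n → Bool
maximalIndepᵇ {n} H S =
  indepᵇ H S ∧
  all (λ T → not (indepᵇ H T ∧ subsetᵇ S T) ∨ subsetᵇ T S) (allSubsets n)

α : ∀ {n} → VGraph n → ℕ
α {n} H = foldr _⊔_ 0 (map ∣_∣ (filterᵇ (indepᵇ H) (allSubsets n)))

-- i(H): minimum size of an inclusion-maximal independent set
-- (n is an upper bound for all sizes and the list is never empty, so this is the true minimum)
iMin : ∀ {n} → VGraph n → ℕ
iMin {n} H = foldr _⊓_ n (map ∣_∣ (filterᵇ (maximalIndepᵇ H) (allSubsets n)))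

N : ∀ {n} → Graph n → Subset n → Subset n
N {n} G I = tabulate (λ v → any (λ u → lookup I u ∧ adj G u v) (allFin n))

_─_ : ∀ {n} → VGraph n → Subset n → VGraph n
_─_ {n} H X = record
  { V = V'
  ; E = λ u v → E H u v ∧ lookup V' u ∧ lookup V' v }
  where V' = tabulate (λ v → lookup (V H) v ∧ not (lookup X v))

data Reach {n : ℕ} (H : VGraph n) (u : Fin n) : Fin n → Set where
  here : u ∈ V H → Reach H u u
  step : ∀ {w v} → Reach H u w → E H w v ≡ true → Reach H u v

IsComponent : ∀ {n} → VGraph n → Subset n → Set
IsComponent {n} H C = Σ (Fin n) λ v → v ∈ V H × (∀ u → (u ∈ C) ⇔ Reach H v u)

IsMaxComponentSize : ∀ {n} → VGraph n → ℕ → Set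
IsMaxComponentSize H n0 =
  (∃[ C ] (IsComponent H C × ∣ C ∣ ≡ n0)) × (∀ C → IsComponent H C → ∣ C ∣ ≤ n0)

-- Let M be a maximum independent set of H and S a minimum maximal independent set of
-- H − N(I), so |S| + k ≤ |M|. Adding, one at a time, components of H on which M beats S
-- gives a union U of at most k components with |S ∩ U| + k ≤ |M ∩ U|. Choosing one
-- I-neighbour for every vertex of U ∩ N(I) gives I₁ ⊆ I with |I₁| ≤ |U| ≤ k·n₀ and
-- U ∩ N(I) ⊆ N(I₁). Extend S ∩ U to a maximal independent set T of H − N(I₁). A vertex
-- of T ∩ U outside S would, by maximality of S, have an S-neighbour, which lies in U and
-- hence in T; so T ∩ U ⊆ S. As U is a union of components, (M ∩ U) ∪ (T ∖ U) is
-- independent in H, and therefore α(H) ≥ |M ∩ U| + |T ∖ U| ≥ |T| + k ≥ i(H − N(I₁)) + k.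
module Submission where

open import Defs hiding (sym)
open import Data.Bool using (Bool; true; false; _∧_; _∨_; not; T?)
import Data.Bool as Bool
open import Data.Bool.ListAction using (all; any)
open import Data.Bool.Properties using (T-≡)
open import Data.Fin using (Fin)
import Data.Fin.Properties as Fin
open import Data.Fin.Subset
  using (Subset; _∈_; _∉_; _⊆_; _⊂_; _⊃_; ∣_∣; ⊤; ⁅_⁆; _∩_; _∪_; ∁; _-_; inside; outside)
  renaming (⊥ to ∅)
open import Data.Fin.Subset.Induction using (⊂-wellFounded; ⊃-wellFounded)
open import Data.Fin.Subset.Properties
open import Data.List using (List; map; foldr; allFin; filterᵇ)
import Data.List.Membership.Propositional as List
open import Data.List.Membership.Propositional using (lose)
open import Data.List.Membership.Propositional.Properties
  using (∈-allFin; ∈-map⁺; ∈-map⁻; ∈-++⁺ˡ; ∈-++⁺ʳ; ∈-filter⁺; ∈-filter⁻; foldr-selective)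
open import Data.List.Properties using (foldr-preservesᵒ)
import Data.List.Relation.Unary.All as All
open import Data.List.Relation.Unary.All.Properties using (all⁺; all⁻)
import Data.List.Relation.Unary.Any as Any
open import Data.List.Relation.Unary.Any.Properties using (any⁺; any⁻)
open import Data.Nat using (ℕ; zero; suc; _≤_; _<_; _≮_; _∸_; _*_; _+_; _⊔_; _⊓_; z≤n; s≤s)
open import Data.Nat.GeneralisedArithmetic using (fold)
open import Data.Nat.Properties
open import Algebra.Properties.CommutativeSemigroup +-commutativeSemigroup using (xy∙z≈xz∙y)
open import Data.Product using (Σ; _×_; _,_; proj₁; proj₂; ∃-syntax)
open import Data.Sum using (_⊎_; inj₁; inj₂; [_,_])
open import Data.Vec using ([]; _∷_; here; there; lookup; tabulate)
open import Data.Vec.Properties using ([]=⇒lookup; lookup⇒[]=; lookup∘tabulate)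
open import Function using (_∘_; id; _⇔_; mk⇔; Equivalence)
open import Induction.WellFounded using (Acc; acc)
open import Relation.Nullary using (Dec; yes; no; contradiction)
open import Relation.Nullary.Decidable using (map′; ¬?; _×-dec_; decidable-stable)
open import Relation.Binary.PropositionalEquality
  using (_≡_; _≢_; refl; sym; trans; cong; cong₂; subst; subst₂; module ≡-Reasoning)

open Equivalence using (to; from)

private
  variable
    n : ℕ

∧-≡-true⇔ : ∀ {a b} → a ∧ b ≡ true ⇔ (a ≡ true × b ≡ true)
∧-≡-true⇔ {true}  {true}  = mk⇔ (λ _ → refl , refl) (λ _ → refl)
∧-≡-true⇔ {true}  {false} = mk⇔ (λ ()) (λ ())
∧-≡-true⇔ {false}         = mk⇔ (λ ()) (λ ())

not-≡-true⇔ : ∀ {a} → not a ≡ true ⇔ a ≢ true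
not-≡-true⇔ {true}  = mk⇔ (λ ()) (λ a≢true → contradiction refl a≢true)
not-≡-true⇔ {false} = mk⇔ (λ _ ()) (λ _ → refl)

not-∨-≡-true⇔ : ∀ {a b} → not a ∨ b ≡ true ⇔ (a ≡ true → b ≡ true)
not-∨-≡-true⇔ {true}  {true}  = mk⇔ (λ _ _ → refl) (λ _ → refl)
not-∨-≡-true⇔ {true}  {false} = mk⇔ (λ ()) (λ a⇒b → a⇒b refl)
not-∨-≡-true⇔ {false}         = mk⇔ (λ _ ()) (λ _ → refl)

not-∧∧-≡-true⇔ : ∀ {a b c} → not (a ∧ b ∧ c) ≡ true ⇔ (a ≡ true → b ≡ true → c ≢ true)
not-∧∧-≡-true⇔ {true}  {true}  {true}  = mk⇔ (λ ()) (λ h → contradiction refl (h refl refl))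
not-∧∧-≡-true⇔ {true}  {true}  {false} = mk⇔ (λ _ _ _ ()) (λ _ → refl)
not-∧∧-≡-true⇔ {true}  {false}         = mk⇔ (λ _ _ ()) (λ _ → refl)
not-∧∧-≡-true⇔ {false}                 = mk⇔ (λ _ ()) (λ _ → refl)

module _ {A : Set} {xs : List A} (complete : ∀ x → x List.∈ xs) (p : A → Bool) where

  all-complete⇔ : all p xs ≡ true ⇔ (∀ x → p x ≡ true)
  all-complete⇔ = mk⇔
    (λ h x → to T-≡ (All.lookup (all⁺ p xs (from T-≡ h)) (complete x)))
    (λ h → to T-≡ (all⁻ p {xs = xs} (All.tabulate λ {x} _ → from T-≡ (h x))))

  any-complete⇔ : any p xs ≡ true ⇔ (∃[ x ] p x ≡ true)
  any-complete⇔ = mk⇔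
    (λ h → let x , px = Any.satisfied (any⁻ p xs (from T-≡ h)) in x , to T-≡ px)
    (λ (x , px) → to T-≡ (any⁺ p (lose (complete x) (from T-≡ px))))

∈-allSubsets : (S : Subset n) → S List.∈ allSubsets n
∈-allSubsets [] = Any.here refl
∈-allSubsets {suc n} (true ∷ S) = ∈-++⁺ˡ (∈-map⁺ (true ∷_) (∈-allSubsets S))
∈-allSubsets {suc n} (false ∷ S) =
  ∈-++⁺ʳ (map (true ∷_) (allSubsets n)) (∈-map⁺ (false ∷_) (∈-allSubsets S))

∈⇔lookup : ∀ {x} {p : Subset n} → x ∈ p ⇔ lookup p x ≡ true
∈⇔lookup = mk⇔ []=⇒lookup (lookup⇒[]= _ _)

subsetᵇ⇔⊆ : ∀ {S T : Subset n} → subsetᵇ S T ≡ true ⇔ S ⊆ T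
subsetᵇ⇔⊆ {S = S} {T} = mk⇔
  (λ h {x} x∈S → from ∈⇔lookup (to not-∨-≡-true⇔ (to all⇔ h x) (to ∈⇔lookup x∈S)))
  (λ S⊆T → from all⇔ λ x → from not-∨-≡-true⇔ λ Sx → to ∈⇔lookup (S⊆T (from ∈⇔lookup Sx)))
  where all⇔ = all-complete⇔ ∈-allFin (λ v → not (lookup S v) ∨ lookup T v)

-- Independent sets

Independent : VGraph n → Subset n → Set
Independent H S = S ⊆ V H × (∀ {u v} → u ∈ S → v ∈ S → E H u v ≢ true)

MaximalIndependent : VGraph n → Subset n → Set
MaximalIndependent H S = Independent H S × (∀ {T} → Independent H T → S ⊆ T → T ⊆ S)

indepᵇ⇔Independent : ∀ {H : VGraph n} {S} → indepᵇ H S ≡ true ⇔ Independent H S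
indepᵇ⇔Independent {n} {H} {S} = mk⇔ ⇒ ⇐
  where
  edgeFree : Fin n → Fin n → Bool
  edgeFree u v = not (lookup S u ∧ lookup S v ∧ E H u v)
  noEdgeFrom : Fin n → Bool
  noEdgeFrom u = all (edgeFree u) (allFin n)
  all⇔ = all-complete⇔ ∈-allFin

  ⇒ : indepᵇ H S ≡ true → Independent H S
  ⇒ h = to subsetᵇ⇔⊆ S⊆V , λ u∈S v∈S →
    to not-∧∧-≡-true⇔ (to (all⇔ (edgeFree _)) (to (all⇔ noEdgeFrom) noEdge _) _)
      (to ∈⇔lookup u∈S) (to ∈⇔lookup v∈S)
    where S⊆V = proj₁ (to ∧-≡-true⇔ h); noEdge = proj₂ (to ∧-≡-true⇔ h)

  ⇐ : Independent H S → indepᵇ H S ≡ true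
  ⇐ (S⊆V , indep) = from ∧-≡-true⇔ (from subsetᵇ⇔⊆ S⊆V ,
    from (all⇔ noEdgeFrom) λ u → from (all⇔ (edgeFree u)) λ v →
      from not-∧∧-≡-true⇔ λ Su Sv → indep (from ∈⇔lookup Su) (from ∈⇔lookup Sv))

maximalIndepᵇ⇔MaximalIndependent :
  ∀ {H : VGraph n} {S} → maximalIndepᵇ H S ≡ true ⇔ MaximalIndependent H S
maximalIndepᵇ⇔MaximalIndependent {n} {H} {S} = mk⇔ ⇒ ⇐
  where
  all⇔ = all-complete⇔ ∈-allSubsets (λ T → not (indepᵇ H T ∧ subsetᵇ S T) ∨ subsetᵇ T S)

  ⇒ : maximalIndepᵇ H S ≡ true → MaximalIndependent H S
  ⇒ h = to indepᵇ⇔Independent indS , λ {T} indT S⊆T →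
    to subsetᵇ⇔⊆ (to not-∨-≡-true⇔ (to all⇔ maxS T)
      (from ∧-≡-true⇔ (from indepᵇ⇔Independent indT , from subsetᵇ⇔⊆ S⊆T)))
    where indS = proj₁ (to ∧-≡-true⇔ h); maxS = proj₂ (to ∧-≡-true⇔ h)

  ⇐ : MaximalIndependent H S → maximalIndepᵇ H S ≡ true
  ⇐ (indS , maxS) = from ∧-≡-true⇔ (from indepᵇ⇔Independent indS ,
    from all⇔ λ T → from not-∨-≡-true⇔ (absorbed T))
    where
    absorbed : ∀ T → indepᵇ H T ∧ subsetᵇ S T ≡ true → subsetᵇ T S ≡ true
    absorbed T h =
      from subsetᵇ⇔⊆ (maxS (to (indepᵇ⇔Independent {H = H} {T}) indT) (to subsetᵇ⇔⊆ S⊆T))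
      where indT = proj₁ (to ∧-≡-true⇔ h); S⊆T = proj₂ (to ∧-≡-true⇔ h)

independent? : (H : VGraph n) (S : Subset n) → Dec (Independent H S)
independent? H S = map′ (to indepᵇ⇔Independent) (from indepᵇ⇔Independent) (indepᵇ H S Bool.≟ true)

∅-independent : (H : VGraph n) → Independent H ∅
∅-independent H = (λ x∈∅ → contradiction x∈∅ ∉⊥) , λ u∈∅ _ → contradiction u∈∅ ∉⊥

independent-⊆ : ∀ {H : VGraph n} {S T} → Independent H T → S ⊆ T → Independent H S
independent-⊆ (T⊆V , indT) S⊆T = T⊆V ∘ S⊆T , λ u∈S v∈S → indT (S⊆T u∈S) (S⊆T v∈S)

∈-∪⁅⁆⁻ : ∀ {p : Subset n} {x y} → y ∈ p ∪ ⁅ x ⁆ → y ∈ p ⊎ y ≡ x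
∈-∪⁅⁆⁻ {p = p} {x} y∈ = [ inj₁ , inj₂ ∘ x∈⁅y⁆⇒x≡y x ] (x∈p∪q⁻ p ⁅ x ⁆ y∈)

∪⁅⁆-⊆ : ∀ {p q : Subset n} {x} → p ⊆ q → x ∈ q → p ∪ ⁅ x ⁆ ⊆ q
∪⁅⁆-⊆ p⊆q x∈q y∈ with ∈-∪⁅⁆⁻ y∈
... | inj₁ y∈p = p⊆q y∈p
... | inj₂ refl = x∈q

⊂-∪⁅⁆ : ∀ {p : Subset n} {x} → x ∉ p → p ⊂ p ∪ ⁅ x ⁆
⊂-∪⁅⁆ {x = x} x∉p = p⊆p∪q _ , x , x∈p∪q⁺ (inj₂ (x∈⁅x⁆ x)) , x∉p

extend-to-maximal : ∀ {H : VGraph n} {S} → Independent H S →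
                    ∃[ T ] MaximalIndependent H T × S ⊆ T
extend-to-maximal {H = H} {S} = go (⊃-wellFounded S)
  where
  go : ∀ {S} → Acc _⊃_ S → Independent H S → ∃[ T ] MaximalIndependent H T × S ⊆ T
  go {S} (acc larger) indS
    with Fin.any? (λ x → ¬? (x ∈? S) ×-dec independent? H (S ∪ ⁅ x ⁆))
  ... | yes (x , x∉S , indS∪x) =
    let T , maxT , S∪x⊆T = go (larger (⊂-∪⁅⁆ x∉S)) indS∪x in T , maxT , S∪x⊆T ∘ p⊆p∪q _
  ... | no cannotGrow = S , (indS , maximal) , id
    where
    maximal : ∀ {T} → Independent H T → S ⊆ T → T ⊆ S
    maximal indT S⊆T {x} x∈T with x ∈? S
    ... | yes x∈S = x∈S
    ... | no x∉S = contradiction (x , x∉S , independent-⊆ indT (∪⁅⁆-⊆ S⊆T x∈T)) cannotGrow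

-- α and iMin as extrema

sizes : (Subset n → Bool) → List ℕ
sizes {n} P = map ∣_∣ (filterᵇ P (allSubsets n))

∈-sizes⁺ : ∀ {P : Subset n → Bool} {S} → P S ≡ true → ∣ S ∣ List.∈ sizes P
∈-sizes⁺ {P = P} {S} PS = ∈-map⁺ ∣_∣ (∈-filter⁺ (T? ∘ P) (∈-allSubsets S) (from T-≡ PS))

∈-sizes⁻ : ∀ {P : Subset n → Bool} {m} → m List.∈ sizes P → ∃[ S ] P S ≡ true × m ≡ ∣ S ∣
∈-sizes⁻ {n} {P = P} m∈ =
  let S , S∈ , m≡ = ∈-map⁻ ∣_∣ {xs = filterᵇ P (allSubsets n)} m∈
  in S , to T-≡ (proj₂ (∈-filter⁻ (T? ∘ P) {xs = allSubsets n} S∈)) , m≡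

≤-foldr-⊔ : ∀ b {x} {xs : List ℕ} → x List.∈ xs → x ≤ foldr _⊔_ b xs
≤-foldr-⊔ b {xs = xs} x∈xs = foldr-preservesᵒ
  (λ y z → [ m≤n⇒m≤n⊔o z , m≤n⇒m≤o⊔n y ]) b xs (inj₂ (Any.map (λ { refl → ≤-refl }) x∈xs))

foldr-⊓-≤ : ∀ b {x} {xs : List ℕ} → x List.∈ xs → foldr _⊓_ b xs ≤ x
foldr-⊓-≤ b {xs = xs} x∈xs = foldr-preservesᵒ
  (λ y z → [ m≤n⇒m⊓o≤n z , m≤n⇒o⊓m≤n y ]) b xs (inj₂ (Any.map (λ { refl → ≤-refl }) x∈xs))

α-maximum : ∀ {H : VGraph n} {S} → Independent H S → ∣ S ∣ ≤ α H
α-maximum {H = H} {S} indS =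
  ≤-foldr-⊔ 0 (∈-sizes⁺ {P = indepᵇ H} {S} (from indepᵇ⇔Independent indS))

α-attained : (H : VGraph n) → ∃[ S ] Independent H S × ∣ S ∣ ≡ α H
α-attained {n} H with foldr-selective ⊔-sel 0 (sizes (indepᵇ H))
... | inj₁ α≡0 = ∅ , ∅-independent H , trans (∣⊥∣≡0 n) (sym α≡0)
... | inj₂ α∈ =
  let S , indS , α≡ = ∈-sizes⁻ {P = indepᵇ H} α∈ in S , to indepᵇ⇔Independent indS , sym α≡

iMin-minimum : ∀ {H : VGraph n} {S} → MaximalIndependent H S → iMin H ≤ ∣ S ∣
iMin-minimum {n} {H} {S} maxS =
  foldr-⊓-≤ n (∈-sizes⁺ {P = maximalIndepᵇ H} {S} (from maximalIndepᵇ⇔MaximalIndependent maxS))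

iMin-attained : (H : VGraph n) → ∃[ S ] MaximalIndependent H S × ∣ S ∣ ≡ iMin H
iMin-attained {n} H with foldr-selective ⊓-sel n (sizes (maximalIndepᵇ H))
... | inj₂ i∈ =
  let S , maxS , i≡ = ∈-sizes⁻ {P = maximalIndepᵇ H} i∈
  in S , to maximalIndepᵇ⇔MaximalIndependent maxS , sym i≡
... | inj₁ i≡n =
  let S , maxS , _ = extend-to-maximal (∅-independent H)
  in S , maxS , ≤-antisym (subst (∣ S ∣ ≤_) (sym i≡n) (∣p∣≤n S)) (iMin-minimum maxS)

Disjoint : Subset n → Subset n → Set
Disjoint p q = ∀ {x} → x ∈ p → x ∉ q

disjoint-tail : ∀ {a b} {p q : Subset n} → Disjoint (a ∷ p) (b ∷ q) → Disjoint p q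
disjoint-tail d x∈p x∈q = d (there x∈p) (there x∈q)

∣p∪q∣≤∣p∣+∣q∣ : (p q : Subset n) → ∣ p ∪ q ∣ ≤ ∣ p ∣ + ∣ q ∣
∣p∪q∣≤∣p∣+∣q∣ [] [] = z≤n
∣p∪q∣≤∣p∣+∣q∣ (inside ∷ p) (inside ∷ q) =
  s≤s (≤-trans (∣p∪q∣≤∣p∣+∣q∣ p q) (+-monoʳ-≤ ∣ p ∣ (n≤1+n ∣ q ∣)))
∣p∪q∣≤∣p∣+∣q∣ (inside ∷ p) (outside ∷ q) = s≤s (∣p∪q∣≤∣p∣+∣q∣ p q)
∣p∪q∣≤∣p∣+∣q∣ (outside ∷ p) (inside ∷ q) =
  subst (suc ∣ p ∪ q ∣ ≤_) (sym (+-suc ∣ p ∣ ∣ q ∣)) (s≤s (∣p∪q∣≤∣p∣+∣q∣ p q))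
∣p∪q∣≤∣p∣+∣q∣ (outside ∷ p) (outside ∷ q) = ∣p∪q∣≤∣p∣+∣q∣ p q

∣p∪q∣≡∣p∣+∣q∣ : (p q : Subset n) → Disjoint p q → ∣ p ∪ q ∣ ≡ ∣ p ∣ + ∣ q ∣
∣p∪q∣≡∣p∣+∣q∣ [] [] _ = refl
∣p∪q∣≡∣p∣+∣q∣ (inside ∷ p) (inside ∷ q) d = contradiction here (d here)
∣p∪q∣≡∣p∣+∣q∣ (inside ∷ p) (outside ∷ q) d = cong suc (∣p∪q∣≡∣p∣+∣q∣ p q (disjoint-tail d))
∣p∪q∣≡∣p∣+∣q∣ (outside ∷ p) (inside ∷ q) d =
  trans (cong suc (∣p∪q∣≡∣p∣+∣q∣ p q (disjoint-tail d))) (sym (+-suc ∣ p ∣ ∣ q ∣))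
∣p∪q∣≡∣p∣+∣q∣ (outside ∷ p) (outside ∷ q) d = ∣p∪q∣≡∣p∣+∣q∣ p q (disjoint-tail d)

∣p∩[q∪r]∣≡∣p∩q∣+∣p∩r∣ : (p q r : Subset n) → Disjoint q r →
                        ∣ p ∩ (q ∪ r) ∣ ≡ ∣ p ∩ q ∣ + ∣ p ∩ r ∣
∣p∩[q∪r]∣≡∣p∩q∣+∣p∩r∣ p q r d = begin
  ∣ p ∩ (q ∪ r) ∣           ≡⟨ cong ∣_∣ (∩-distribˡ-∪ p q r) ⟩
  ∣ (p ∩ q) ∪ (p ∩ r) ∣     ≡⟨ ∣p∪q∣≡∣p∣+∣q∣ (p ∩ q) (p ∩ r) (λ x∈pq x∈pr →
                                 d (proj₂ (x∈p∩q⁻ p q x∈pq)) (proj₂ (x∈p∩q⁻ p r x∈pr))) ⟩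
  ∣ p ∩ q ∣ + ∣ p ∩ r ∣     ∎
  where open ≡-Reasoning

∣p∣≡∣p∩q∣+∣p∩∁q∣ : (p q : Subset n) → ∣ p ∣ ≡ ∣ p ∩ q ∣ + ∣ p ∩ ∁ q ∣
∣p∣≡∣p∩q∣+∣p∩∁q∣ p q = begin
  ∣ p ∣                     ≡⟨ cong ∣_∣ (sym (∩-identityʳ p)) ⟩
  ∣ p ∩ ⊤ ∣                 ≡⟨ cong (λ r → ∣ p ∩ r ∣) (sym (p∪∁p≡⊤ q)) ⟩
  ∣ p ∩ (q ∪ ∁ q) ∣         ≡⟨ ∣p∩[q∪r]∣≡∣p∩q∣+∣p∩r∣ p q (∁ q) x∈p⇒x∉∁p ⟩
  ∣ p ∩ q ∣ + ∣ p ∩ ∁ q ∣   ∎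
  where open ≡-Reasoning

∣p∩r∣≡∣p∩q∣+∣p∩r∩∁q∣ : (p : Subset n) {q r : Subset n} → q ⊆ r →
                       ∣ p ∩ r ∣ ≡ ∣ p ∩ q ∣ + ∣ p ∩ r ∩ ∁ q ∣
∣p∩r∣≡∣p∩q∣+∣p∩r∩∁q∣ p {q} {r} q⊆r = begin
  ∣ p ∩ r ∣                              ≡⟨ ∣p∣≡∣p∩q∣+∣p∩∁q∣ (p ∩ r) q ⟩
  ∣ (p ∩ r) ∩ q ∣ + ∣ (p ∩ r) ∩ ∁ q ∣    ≡⟨ cong₂ (λ s t → ∣ s ∣ + ∣ t ∣)
                                              (∩-assoc p r q) (∩-assoc p r (∁ q)) ⟩
  ∣ p ∩ r ∩ q ∣ + ∣ p ∩ r ∩ ∁ q ∣        ≡⟨ cong (λ s → ∣ p ∩ s ∣ + ∣ p ∩ r ∩ ∁ q ∣) r∩q≡q ⟩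
  ∣ p ∩ q ∣ + ∣ p ∩ r ∩ ∁ q ∣            ∎
  where
  open ≡-Reasoning
  r∩q≡q : r ∩ q ≡ q
  r∩q≡q = ⊆-antisym (p∩q⊆q r q) (λ x∈q → x∈p∩q⁺ (q⊆r x∈q , x∈q))

-- Neighbourhoods and vertex deletion

neighbours : (Fin n → Fin n → Bool) → Subset n → Subset n
neighbours {n} R p = tabulate (λ v → any (λ u → lookup p u ∧ R u v) (allFin n))

∈-neighbours⇔ : ∀ R (p : Subset n) {v} → v ∈ neighbours R p ⇔ (∃[ u ] u ∈ p × R u v ≡ true)
∈-neighbours⇔ {n} R p {v} = mk⇔
  (λ v∈ → let u , h = to any⇔ (trans (sym (lookup∘tabulate _ v)) (to ∈⇔lookup v∈))
          in u , from ∈⇔lookup (proj₁ (to ∧-≡-true⇔ h)) , proj₂ (to ∧-≡-true⇔ h))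
  (λ (u , u∈p , Ruv) → from ∈⇔lookup
    (trans (lookup∘tabulate _ v) (from any⇔ (u , from ∧-≡-true⇔ (to ∈⇔lookup u∈p , Ruv)))))
  where any⇔ = any-complete⇔ ∈-allFin (λ u → lookup p u ∧ R u v)

neighbours-mono : ∀ {R} {p q : Subset n} → p ⊆ q → neighbours R p ⊆ neighbours R q
neighbours-mono {R = R} {p} {q} p⊆q v∈ =
  let u , u∈p , Ruv = to (∈-neighbours⇔ R p) v∈ in from (∈-neighbours⇔ R q) (u , p⊆q u∈p , Ruv)

neighbours-cover : ∀ {R} {I D : Subset n} → D ⊆ neighbours R I →
                   ∃[ J ] J ⊆ I × ∣ J ∣ ≤ ∣ D ∣ × D ⊆ neighbours R J
neighbours-cover {n} {R} {I} {D} = go (⊂-wellFounded D)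
  where
  go : ∀ {D} → Acc _⊂_ D → D ⊆ neighbours R I → ∃[ J ] J ⊆ I × ∣ J ∣ ≤ ∣ D ∣ × D ⊆ neighbours R J
  go {D} (acc smaller) D⊆N with nonempty? D
  ... | no empty =
    ∅ , ⊥⊆ , subst (_≤ ∣ D ∣) (sym (∣⊥∣≡0 n)) z≤n , λ v∈D → contradiction (_ , v∈D) empty
  ... | yes (v , v∈D)
    with to (∈-neighbours⇔ R I) (D⊆N v∈D) | go (smaller (x∈p⇒p-x⊂p v∈D)) (D⊆N ∘ p─q⊆p D ⁅ v ⁆)
  ...   | u , u∈I , Ruv | J , J⊆I , ∣J∣≤ , D-v⊆NJ = J ∪ ⁅ u ⁆ , ∪⁅⁆-⊆ J⊆I u∈I , size , cover
    where
    size : ∣ J ∪ ⁅ u ⁆ ∣ ≤ ∣ D ∣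
    size = begin
      ∣ J ∪ ⁅ u ⁆ ∣        ≤⟨ ∣p∪q∣≤∣p∣+∣q∣ J ⁅ u ⁆ ⟩
      ∣ J ∣ + ∣ ⁅ u ⁆ ∣    ≡⟨ cong (∣ J ∣ +_) (∣⁅x⁆∣≡1 u) ⟩
      ∣ J ∣ + 1            ≡⟨ +-comm ∣ J ∣ 1 ⟩
      suc ∣ J ∣            ≤⟨ s≤s ∣J∣≤ ⟩
      suc ∣ D - v ∣        ≤⟨ x∈p⇒∣p-x∣<∣p∣ v∈D ⟩
      ∣ D ∣                ∎
      where open ≤-Reasoning

    cover : D ⊆ neighbours R (J ∪ ⁅ u ⁆)
    cover {w} w∈D with w Fin.≟ v
    ... | yes refl = from (∈-neighbours⇔ R (J ∪ ⁅ u ⁆)) (u , x∈p∪q⁺ (inj₂ (x∈⁅x⁆ u)) , Ruv)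
    ... | no w≢v = neighbours-mono {R = R} {J} (p⊆p∪q ⁅ u ⁆) (D-v⊆NJ (x∈p∧x≢y⇒x∈p-y w∈D w≢v))

∈-V─⇔ : ∀ {H : VGraph n} {X v} → v ∈ V (H ─ X) ⇔ (v ∈ V H × v ∉ X)
∈-V─⇔ {H = H} {X} {v} = mk⇔
  (λ v∈ → let inH , notX = to ∧-≡-true⇔ (trans (sym lookup-V─) (to ∈⇔lookup v∈))
          in from ∈⇔lookup inH , λ v∈X → to not-≡-true⇔ notX (to ∈⇔lookup v∈X))
  (λ (v∈V , v∉X) → from ∈⇔lookup (trans lookup-V─
    (from ∧-≡-true⇔ (to ∈⇔lookup v∈V , from not-≡-true⇔ (v∉X ∘ from ∈⇔lookup)))))
  where
  lookup-V─ : lookup (V (H ─ X)) v ≡ lookup (V H) v ∧ not (lookup X v)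
  lookup-V─ = lookup∘tabulate _ v

independent-─⇔ : ∀ (H : VGraph n) X {S} → Independent (H ─ X) S ⇔ (Independent H S × Disjoint S X)
independent-─⇔ H X {S} = mk⇔
  (λ (S⊆V , indep) →
    (proj₁ ∘ to V─⇔ ∘ S⊆V , λ u∈S v∈S Euv → indep u∈S v∈S (from ∧-≡-true⇔ (Euv ,
      from ∧-≡-true⇔ (to ∈⇔lookup (S⊆V u∈S) , to ∈⇔lookup (S⊆V v∈S))))) ,
    proj₂ ∘ to V─⇔ ∘ S⊆V)
  (λ ((S⊆V , indep) , S∩X=∅) →
    (λ v∈S → from V─⇔ (S⊆V v∈S , S∩X=∅ v∈S)) ,
    λ u∈S v∈S Euv → indep u∈S v∈S (proj₁ (to ∧-≡-true⇔ Euv)))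
  where V─⇔ = λ {v} → ∈-V─⇔ {H = H} {X} {v}

independent-─-mono : ∀ (H : VGraph n) {X Y S T} → Y ⊆ X → T ⊆ S →
                     Independent (H ─ X) S → Independent (H ─ Y) T
independent-─-mono H {X} {Y} Y⊆X T⊆S indS =
  let indS-H , S∩X=∅ = to (independent-─⇔ H X) indS
  in from (independent-─⇔ H Y) (independent-⊆ indS-H T⊆S , λ v∈T v∈Y → S∩X=∅ (T⊆S v∈T) (Y⊆X v∈Y))

-- Closed sets and connected components

⊆⊎∃∉ : (p q : Subset n) → p ⊆ q ⊎ ∃[ x ] x ∈ p × x ∉ q
⊆⊎∃∉ p q with Fin.any? (λ x → x ∈? p ×-dec ¬? (x ∈? q))
... | yes witness = inj₂ witness
... | no none = inj₁ λ {x} x∈p → decidable-stable (x ∈? q) (λ x∉q → none (x , x∈p , x∉q))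

module _ (f : Subset n → Subset n) (inflationary : ∀ {p} → p ⊆ f p) where

  fold-inflationary : ∀ {p} j → p ⊆ fold p f j
  fold-inflationary zero = id
  fold-inflationary (suc j) = inflationary ∘ fold-inflationary j

  -- Until it stabilises, every iteration adds at least one element.
  fold-stable-or-large : ∀ p j → f (fold p f j) ⊆ fold p f j ⊎ j ≤ ∣ fold p f j ∣
  fold-stable-or-large p zero = inj₂ z≤n
  fold-stable-or-large p (suc j) with ⊆⊎∃∉ (f (fold p f j)) (fold p f j) | fold-stable-or-large p j
  ... | inj₁ stable | _ = inj₁ (subst (λ q → f q ⊆ q) (sym (⊆-antisym stable inflationary)) stable)
  ... | inj₂ (x , x∈ , x∉) | inj₁ stable = contradiction (stable x∈) x∉
  ... | inj₂ (x , x∈ , x∉) | inj₂ j≤ =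
    inj₂ (≤-trans (s≤s j≤) (p⊂q⇒∣p∣<∣q∣ (inflationary , x , x∈ , x∉)))

  fold-stable : ∀ p → f (fold p f n) ⊆ fold p f n
  fold-stable p with fold-stable-or-large p n
  ... | inj₁ stable = stable
  ... | inj₂ n≤ =
    subst (λ q → f q ⊆ q) (sym (∣p∣≡n⇒p≡⊤ (≤-antisym (∣p∣≤n (fold p f n)) n≤))) (λ _ → ∈⊤)

Closed : VGraph n → Subset n → Set
Closed H U = ∀ {u v} → E H u v ≡ true → u ∈ U → v ∈ U

expand : VGraph n → Subset n → Subset n
expand H p = p ∪ neighbours (E H) p

component : VGraph n → Fin n → Subset n
component {n} H x = fold ⁅ x ⁆ (expand H) n

module _ {H : VGraph n} where

  closed-∪ : ∀ {U W} → Closed H U → Closed H W → Closed H (U ∪ W)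
  closed-∪ {U} {W} cU cW e u∈ = x∈p∪q⁺ ([ inj₁ ∘ cU e , inj₂ ∘ cW e ] (x∈p∪q⁻ U W u∈))

  closed-∩ : ∀ {U W} → Closed H U → Closed H W → Closed H (U ∩ W)
  closed-∩ {U} {W} cU cW e u∈ =
    let u∈U , u∈W = x∈p∩q⁻ U W u∈ in x∈p∩q⁺ (cU e u∈U , cW e u∈W)

  x∈component : ∀ {x} → x ∈ component H x
  x∈component {x} = fold-inflationary (expand H) (p⊆p∪q _) n (x∈⁅x⁆ x)

  component-closed : ∀ {x} → Closed H (component H x)
  component-closed {x} e u∈C = fold-stable (expand H) (p⊆p∪q _) ⁅ x ⁆
    (x∈p∪q⁺ (inj₂ (from (∈-neighbours⇔ (E H) _) (_ , u∈C , e))))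

  reach-closed : ∀ {U x u} → Closed H U → x ∈ U → Reach H x u → u ∈ U
  reach-closed cU x∈U (here _) = x∈U
  reach-closed cU x∈U (step r e) = cU e (reach-closed cU x∈U r)

  fold-expand-reach : ∀ {x u} → x ∈ V H → ∀ j → u ∈ fold ⁅ x ⁆ (expand H) j → Reach H x u
  fold-expand-reach {x} x∈V zero u∈ = subst (Reach H x) (sym (x∈⁅y⁆⇒x≡y x u∈)) (here x∈V)
  fold-expand-reach {x} x∈V (suc j) u∈ with x∈p∪q⁻ _ _ u∈
  ... | inj₁ u∈prev = fold-expand-reach x∈V j u∈prev
  ... | inj₂ u∈nb = let w , w∈prev , e = to (∈-neighbours⇔ (E H) _) u∈nb
                    in step (fold-expand-reach x∈V j w∈prev) e

  component-isComponent : ∀ {x} → x ∈ V H → IsComponent H (component H x)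
  component-isComponent {x} x∈V =
    x , x∈V , λ u → mk⇔ (fold-expand-reach x∈V n) (reach-closed component-closed x∈component)

  component-⊆ : ∀ {x U} → x ∈ V H → Closed H U → x ∈ U → component H x ⊆ U
  component-⊆ x∈V cU x∈U = reach-closed cU x∈U ∘ fold-expand-reach x∈V n

module _ {H : VGraph n}
         (symmetric : ∀ {u v} → E H u v ≡ true → E H v u ≡ true)
         (loopless : ∀ {v} → E H v v ≢ true) where

  closed-∁ : ∀ {U} → Closed H U → Closed H (∁ U)
  closed-∁ cU e u∈∁U = x∉p⇒x∈∁p λ v∈U → x∈∁p⇒x∉p u∈∁U (cU (symmetric e) v∈U)

  exchange : ∀ {U A B} → Closed H U → Independent H A → Independent H B →
             Independent H ((A ∩ U) ∪ (B ∩ ∁ U))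
  exchange {U} {A} {B} cU (A⊆V , indA) (B⊆V , indB) = vertices , noEdge
    where
    vertices : (A ∩ U) ∪ (B ∩ ∁ U) ⊆ V H
    vertices x∈ = [ A⊆V ∘ p∩q⊆p A U , B⊆V ∘ p∩q⊆p B (∁ U) ] (x∈p∪q⁻ _ _ x∈)

    noEdge : ∀ {u v} → u ∈ (A ∩ U) ∪ (B ∩ ∁ U) → v ∈ (A ∩ U) ∪ (B ∩ ∁ U) → E H u v ≢ true
    noEdge u∈ v∈ e with x∈p∪q⁻ _ _ u∈ | x∈p∪q⁻ _ _ v∈
    ... | inj₁ u∈AU | inj₁ v∈AU = indA (proj₁ (x∈p∩q⁻ A U u∈AU)) (proj₁ (x∈p∩q⁻ A U v∈AU)) e
    ... | inj₂ u∈BU | inj₂ v∈BU = indB (proj₁ (x∈p∩q⁻ B _ u∈BU)) (proj₁ (x∈p∩q⁻ B _ v∈BU)) e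
    ... | inj₁ u∈AU | inj₂ v∈BU =
      x∈∁p⇒x∉p (proj₂ (x∈p∩q⁻ B _ v∈BU)) (cU e (proj₂ (x∈p∩q⁻ A U u∈AU)))
    ... | inj₂ u∈BU | inj₁ v∈AU =
      x∈∁p⇒x∉p (closed-∁ cU e (proj₂ (x∈p∩q⁻ B _ u∈BU))) (proj₂ (x∈p∩q⁻ A U v∈AU))

  independent-∪⁅⁆ : ∀ {S w} → Independent H S → w ∈ V H → (∀ {s} → s ∈ S → E H s w ≢ true) →
                    Independent H (S ∪ ⁅ w ⁆)
  independent-∪⁅⁆ {S} {w} (S⊆V , indS) w∈V isolated = ∪⁅⁆-⊆ S⊆V w∈V , noEdge
    where
    noEdge : ∀ {u v} → u ∈ S ∪ ⁅ w ⁆ → v ∈ S ∪ ⁅ w ⁆ → E H u v ≢ true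
    noEdge u∈ v∈ with ∈-∪⁅⁆⁻ u∈ | ∈-∪⁅⁆⁻ v∈
    ... | inj₁ u∈S | inj₁ v∈S = indS u∈S v∈S
    ... | inj₁ u∈S | inj₂ refl = isolated u∈S
    ... | inj₂ refl | inj₁ v∈S = isolated v∈S ∘ symmetric
    ... | inj₂ refl | inj₂ refl = loopless

  maximal-trace : ∀ {X Y S T U} → MaximalIndependent (H ─ X) S → Closed H U →
                  (∀ {v} → v ∈ U → v ∈ X → v ∈ Y) →
                  Independent (H ─ Y) T → S ∩ U ⊆ T → T ∩ U ⊆ S
  maximal-trace {X} {Y} {S} {T} {U} (indS , maxS) cU U∩X⊆Y indT S∩U⊆T {w} w∈T∩U with w ∈? S
  ... | yes w∈S = w∈S
  ... | no w∉S = contradiction (maxS indS∪w (p⊆p∪q ⁅ w ⁆) (x∈p∪q⁺ (inj₂ (x∈⁅x⁆ w)))) w∉S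
    where
    w∈T = proj₁ (x∈p∩q⁻ T U w∈T∩U)
    w∈U = proj₂ (x∈p∩q⁻ T U w∈T∩U)
    indT-H = to (independent-─⇔ H Y) indT
    indS-H = to (independent-─⇔ H X) indS

    isolated : ∀ {s} → s ∈ S → E H s w ≢ true
    isolated s∈S e = proj₂ (proj₁ indT-H) (S∩U⊆T (x∈p∩q⁺ (s∈S , cU (symmetric e) w∈U))) w∈T e

    w∉X : w ∉ X
    w∉X w∈X = proj₂ indT-H w∈T (U∩X⊆Y w∈U w∈X)

    indS∪w : Independent (H ─ X) (S ∪ ⁅ w ⁆)
    indS∪w = from (independent-─⇔ H X)
      ( independent-∪⁅⁆ (proj₁ indS-H) (proj₁ (proj₁ indT-H) w∈T) isolated
      , λ v∈ → [ proj₂ indS-H , (λ { refl → w∉X }) ] (∈-∪⁅⁆⁻ v∈) )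

  surplus⇒gap : ∀ {X Y M S U k} → Y ⊆ X → Closed H U → (∀ {v} → v ∈ U → v ∈ X → v ∈ Y) →
                Independent H M → MaximalIndependent (H ─ X) S →
                ∣ S ∩ U ∣ + k ≤ ∣ M ∩ U ∣ → k ≤ α H ∸ iMin (H ─ Y)
  surplus⇒gap {X} {Y} {M} {S} {U} {k} Y⊆X cU U∩X⊆Y indM maxS surplus
    with extend-to-maximal (independent-─-mono H Y⊆X (p∩q⊆p S U) (proj₁ maxS))
  ... | T , maxT , S∩U⊆T = m+n≤o⇒m≤o∸n k (subst (_≤ α H) (+-comm (iMin (H ─ Y)) k) bound)
    where
    T∩U⊆S∩U : T ∩ U ⊆ S ∩ U
    T∩U⊆S∩U x∈ = x∈p∩q⁺ (maximal-trace maxS cU U∩X⊆Y (proj₁ maxT) S∩U⊆T x∈ , proj₂ (x∈p∩q⁻ T U x∈))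

    indT-H : Independent H T
    indT-H = proj₁ (to (independent-─⇔ H Y) (proj₁ maxT))

    disjoint : Disjoint (M ∩ U) (T ∩ ∁ U)
    disjoint x∈MU x∈TU = x∈∁p⇒x∉p (proj₂ (x∈p∩q⁻ T _ x∈TU)) (proj₂ (x∈p∩q⁻ M U x∈MU))

    bound : iMin (H ─ Y) + k ≤ α H
    bound = begin
      iMin (H ─ Y) + k                ≤⟨ +-monoˡ-≤ k (iMin-minimum maxT) ⟩
      ∣ T ∣ + k                       ≡⟨ cong (_+ k) (∣p∣≡∣p∩q∣+∣p∩∁q∣ T U) ⟩
      ∣ T ∩ U ∣ + ∣ T ∩ ∁ U ∣ + k      ≤⟨ +-monoˡ-≤ k (+-monoˡ-≤ _ (p⊆q⇒∣p∣≤∣q∣ T∩U⊆S∩U)) ⟩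
      ∣ S ∩ U ∣ + ∣ T ∩ ∁ U ∣ + k      ≡⟨ xy∙z≈xz∙y ∣ S ∩ U ∣ _ k ⟩
      ∣ S ∩ U ∣ + k + ∣ T ∩ ∁ U ∣      ≤⟨ +-monoˡ-≤ _ surplus ⟩
      ∣ M ∩ U ∣ + ∣ T ∩ ∁ U ∣          ≡⟨ sym (∣p∪q∣≡∣p∣+∣q∣ (M ∩ U) (T ∩ ∁ U) disjoint) ⟩
      ∣ (M ∩ U) ∪ (T ∩ ∁ U) ∣         ≤⟨ α-maximum (exchange cU indM indT-H) ⟩
      α H                             ∎
      where open ≤-Reasoning

  surplus-component : ∀ {M S Y} → M ⊆ V H → Closed H Y → ∣ S ∩ Y ∣ < ∣ M ∩ Y ∣ →
                      ∃[ x ] x ∈ V H × component H x ⊆ Y ×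
                             ∣ S ∩ component H x ∣ < ∣ M ∩ component H x ∣
  surplus-component {M} {S} {Y} M⊆V = go (⊂-wellFounded Y)
    where
    go : ∀ {Y} → Acc _⊂_ Y → Closed H Y → ∣ S ∩ Y ∣ < ∣ M ∩ Y ∣ →
         ∃[ x ] x ∈ V H × component H x ⊆ Y × ∣ S ∩ component H x ∣ < ∣ M ∩ component H x ∣
    go {Y} (acc smaller) cY surplus with nonempty? (M ∩ Y)
    ... | no empty = contradiction surplus
          (subst (∣ S ∩ Y ∣ ≮_) (sym (trans (cong ∣_∣ (Empty-unique empty)) (∣⊥∣≡0 n))) n≮0)
    ... | yes (x , x∈M∩Y) = split (∣ S ∩ C ∣ <? ∣ M ∩ C ∣)
      where
      C = component H x
      x∈V = M⊆V (proj₁ (x∈p∩q⁻ M Y x∈M∩Y))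
      x∈Y = proj₂ (x∈p∩q⁻ M Y x∈M∩Y)
      C⊆Y = component-⊆ x∈V cY x∈Y
      Y′ = Y ∩ ∁ C

      Y′⊂Y : Y′ ⊂ Y
      Y′⊂Y = p∩q⊆p Y (∁ C) , x , x∈Y ,
             λ x∈Y′ → x∈∁p⇒x∉p (proj₂ (x∈p∩q⁻ Y (∁ C) x∈Y′)) (x∈component {H = H} {x})

      split : Dec (∣ S ∩ C ∣ < ∣ M ∩ C ∣) →
              ∃[ x ] x ∈ V H × component H x ⊆ Y × ∣ S ∩ component H x ∣ < ∣ M ∩ component H x ∣
      split (yes gain) = x , x∈V , C⊆Y , gain
      split (no noGain) =
        let x′ , x′∈V , C′⊆Y′ , gain′ = go (smaller Y′⊂Y) cY′ surplus′
        in x′ , x′∈V , p∩q⊆p Y (∁ C) ∘ C′⊆Y′ , gain′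
        where
        cY′ : Closed H Y′
        cY′ = closed-∩ {H = H} cY (closed-∁ (component-closed {H = H} {x}))

        surplus′ : ∣ S ∩ Y′ ∣ < ∣ M ∩ Y′ ∣
        surplus′ = +-cancelˡ-< ∣ S ∩ C ∣ _ _ (begin-strict
          ∣ S ∩ C ∣ + ∣ S ∩ Y′ ∣   ≡⟨ sym (∣p∩r∣≡∣p∩q∣+∣p∩r∩∁q∣ S C⊆Y) ⟩
          ∣ S ∩ Y ∣               <⟨ surplus ⟩
          ∣ M ∩ Y ∣               ≡⟨ ∣p∩r∣≡∣p∩q∣+∣p∩r∩∁q∣ M C⊆Y ⟩
          ∣ M ∩ C ∣ + ∣ M ∩ Y′ ∣   ≤⟨ +-monoˡ-≤ _ (≮⇒≥ noGain) ⟩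
          ∣ S ∩ C ∣ + ∣ M ∩ Y′ ∣   ∎)
          where open ≤-Reasoning

  -- Either U already has surplus k + 1, or M beats S outside U and a component
  -- with positive surplus can be added.
  surplus-selection : ∀ {M S n0} → M ⊆ V H → (∀ {x} → x ∈ V H → ∣ component H x ∣ ≤ n0) →
                      ∀ k → k ≤ ∣ M ∣ ∸ ∣ S ∣ →
                      ∃[ U ] Closed H U × ∣ U ∣ ≤ k * n0 × ∣ S ∩ U ∣ + k ≤ ∣ M ∩ U ∣
  surplus-selection {M} {S} _ _ zero _ =
    ∅ , (λ _ u∈∅ → contradiction u∈∅ ∉⊥) , ≤-reflexive (∣⊥∣≡0 n) ,
    subst (_≤ ∣ M ∩ ∅ ∣) (sym (trans (+-identityʳ _) (trans (cong ∣_∣ (∩-zeroʳ S)) (∣⊥∣≡0 n)))) z≤n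
  surplus-selection {M} {S} {n0} M⊆V small (suc k) k<gap
    with surplus-selection {S = S} M⊆V small k (≤-trans (n≤1+n k) k<gap)
  ... | U , cU , ∣U∣≤ , surplusU with ∣ S ∩ U ∣ + suc k ≤? ∣ M ∩ U ∣
  ...   | yes enough = U , cU , ≤-trans ∣U∣≤ (*-monoˡ-≤ n0 (n≤1+n k)) , enough
  ...   | no short = grow (surplus-component {S = S} M⊆V (closed-∁ cU) surplus-outside)
    where
    total : ∣ S ∣ + suc k ≤ ∣ M ∣
    total = subst (_≤ ∣ M ∣) (+-comm (suc k) ∣ S ∣) (m≤o∸n⇒m+n≤o (suc k) S≤M k<gap)
      where S≤M = <⇒≤ (m∸n≢0⇒n<m λ gap≡0 → contradiction (subst (suc k ≤_) gap≡0 k<gap) λ ())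

    surplus-outside : ∣ S ∩ ∁ U ∣ < ∣ M ∩ ∁ U ∣
    surplus-outside = +-cancelˡ-< (∣ S ∩ U ∣ + suc k) _ _ (begin-strict
      ∣ S ∩ U ∣ + suc k + ∣ S ∩ ∁ U ∣  ≡⟨ xy∙z≈xz∙y ∣ S ∩ U ∣ (suc k) _ ⟩
      ∣ S ∩ U ∣ + ∣ S ∩ ∁ U ∣ + suc k  ≡⟨ cong (_+ suc k) (sym (∣p∣≡∣p∩q∣+∣p∩∁q∣ S U)) ⟩
      ∣ S ∣ + suc k                    ≤⟨ total ⟩
      ∣ M ∣                            ≡⟨ ∣p∣≡∣p∩q∣+∣p∩∁q∣ M U ⟩
      ∣ M ∩ U ∣ + ∣ M ∩ ∁ U ∣           <⟨ +-monoˡ-< _ (≰⇒> short) ⟩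
      ∣ S ∩ U ∣ + suc k + ∣ M ∩ ∁ U ∣  ∎)
      where open ≤-Reasoning

    grow : (∃[ x ] x ∈ V H × component H x ⊆ ∁ U ×
                   ∣ S ∩ component H x ∣ < ∣ M ∩ component H x ∣) →
           ∃[ U′ ] Closed H U′ × ∣ U′ ∣ ≤ suc k * n0 × ∣ S ∩ U′ ∣ + suc k ≤ ∣ M ∩ U′ ∣
    grow (x , x∈V , C⊆∁U , gain) =
      U ∪ C , closed-∪ {H = H} cU (component-closed {H = H}) , size , surplus′
      where
      C = component H x

      U∩C=∅ : Disjoint U C
      U∩C=∅ u∈U u∈C = x∈∁p⇒x∉p (C⊆∁U u∈C) u∈U

      size : ∣ U ∪ C ∣ ≤ suc k * n0
      size = ≤-trans (∣p∪q∣≤∣p∣+∣q∣ U C)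
                     (subst (∣ U ∣ + ∣ C ∣ ≤_) (+-comm (k * n0) n0) (+-mono-≤ ∣U∣≤ (small x∈V)))

      surplus′ : ∣ S ∩ (U ∪ C) ∣ + suc k ≤ ∣ M ∩ (U ∪ C) ∣
      surplus′ = begin
        ∣ S ∩ (U ∪ C) ∣ + suc k          ≡⟨ cong (_+ suc k) (∣p∩[q∪r]∣≡∣p∩q∣+∣p∩r∣ S U C U∩C=∅) ⟩
        ∣ S ∩ U ∣ + ∣ S ∩ C ∣ + suc k    ≡⟨ xy∙z≈xz∙y ∣ S ∩ U ∣ _ (suc k) ⟩
        ∣ S ∩ U ∣ + suc k + ∣ S ∩ C ∣    ≡⟨ cong (_+ ∣ S ∩ C ∣) (+-suc ∣ S ∩ U ∣ k) ⟩
        suc (∣ S ∩ U ∣ + k) + ∣ S ∩ C ∣  ≡⟨ sym (+-suc (∣ S ∩ U ∣ + k) _) ⟩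
        ∣ S ∩ U ∣ + k + suc ∣ S ∩ C ∣    ≤⟨ +-mono-≤ surplusU gain ⟩
        ∣ M ∩ U ∣ + ∣ M ∩ C ∣            ≡⟨ sym (∣p∩[q∪r]∣≡∣p∩q∣+∣p∩r∣ M U C U∩C=∅) ⟩
        ∣ M ∩ (U ∪ C) ∣                  ∎
        where open ≤-Reasoning

  few-sources-suffice : ∀ {G : Graph n} {I M S n0} →
    Independent H M → MaximalIndependent (H ─ N G I) S →
    (∀ {x} → x ∈ V H → ∣ component H x ∣ ≤ n0) → ∀ k → k ≤ ∣ M ∣ ∸ ∣ S ∣ →
    ∃[ J ] J ⊆ I × ∣ J ∣ ≤ k * n0 × k ≤ α H ∸ iMin (H ─ N G J)
  few-sources-suffice {G = G} {I} {M} {S} indM maxS small k k≤gap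
    with surplus-selection {S = S} (proj₁ indM) small k k≤gap
  ... | U , cU , ∣U∣≤ , surplus
    with neighbours-cover {R = adj G} {I} {U ∩ N G I} (p∩q⊆q U (N G I))
  ... | J , J⊆I , ∣J∣≤ , U∩NI⊆NJ =
    J , J⊆I , ≤-trans ∣J∣≤ (≤-trans (∣p∩q∣≤∣p∣ U (N G I)) ∣U∣≤) ,
    surplus⇒gap (neighbours-mono J⊆I) cU (λ v∈U v∈NI → U∩NI⊆NJ (x∈p∩q⁺ (v∈U , v∈NI)))
      indM maxS surplus

lemma2p8 : ∀ {n} (G : Graph n) (H : VGraph n) → IsSubgraph G H → NonNull H →
    ∀ (n0 : ℕ) → IsMaxComponentSize H n0 →
    ∀ (I : Subset n) → indepᵇ (asV G) I ≡ true → (∀ v → v ∈ I → v ∉ V H) →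
    ∀ (k : ℕ) → k ≤ α H ∸ iMin (H ─ N G I) →
    Σ (Subset n) λ I₁ → I₁ ⊆ I × ∣ I₁ ∣ ≤ k * n0 × k ≤ α H ∸ iMin (H ─ N G I₁)
lemma2p8 G H sub _ n0 (_ , n0-max) I _ _ k k≤gap
  with α-attained H | iMin-attained (H ─ N G I)
... | M , indM , ∣M∣≡α | S , maxS , ∣S∣≡i =
  few-sources-suffice symmetric loopless {G = G} {I} indM maxS
    (λ x∈V → n0-max _ (component-isComponent x∈V)) k
    (subst₂ (λ a b → k ≤ a ∸ b) (sym ∣M∣≡α) (sym ∣S∣≡i) k≤gap)
  where
  open IsSubgraph sub
  symmetric : ∀ {u v} → E H u v ≡ true → E H v u ≡ true
  symmetric {u} {v} = trans (E-sym v u)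
  loopless : ∀ {v} → E H v v ≢ true
  loopless {v} e with trans (sym (E-sub v v e)) (irrefl G v)
  ... | ()
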